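{- Let $G$ be a simple graph with vertex set $\{v_1,\dots,v_n\}$ and let $J$ be a symmetric subgraph of $K_{n,n}$. Suppose that for all $i\neq j$ with $i,j\in\{1,\dots,n\}$, $J$ does not contain both the edge $(i,i')$ and the pair of edges $(i,j'),(j,i')$. Then $\chi_\infty(G,J)\le 2n$.
   Context: Let $K_{n,n}$ be the complete bipartite graph with parts $I_n=\{1,\dots,n\}$ and $I_n'=\{1',\dots,n'\}$; a subgraph $J$ of $K_{n,n}$ with vertex set $I_n\cup I_n'$ is symmetric if $i\sim j'$ iff $j\sim i'$. The self-similar graphs based on $(G,J)$: $G^1=G$; for $k\ge2$, $V(G^k)=V(G)^k$, and $(v_{i_1},\dots,v_{i_k})\sim(v_{j_1},\dots,v_{j_k})$ in $G^k$ iff either (1) $(v_{i_1},\dots,v_{i_{k-1}})=(v_{j_1},\dots,v_{j_{k-1}})$ and $v_{i_k}\sim v_{j_k}$ in $G$, or (2) $(v_{i_1},\dots,v_{i_{k-1}})\sim(v_{j_1},\dots,v_{j_{k-1}})$ in $G^{k-1}$ and $i_k\sim j_k'$ in $J$. The sequence $\chi(G^k)$ is non-decreasing; $\chi_\infty(G,J)$ denotes its limit, with $\chi_\infty(G,J)=\infty$ if it is unbounded. -}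

module Defs where

open import Data.Nat using (ℕ; zero; suc; _*_)
open import Data.Fin using (Fin)
open import Data.Bool using (Bool; true; false)
open import Data.Product using (_×_; _,_; ∃)
open import Data.Sum using (_⊎_)
open import Relation.Binary.PropositionalEquality using (_≡_; _≢_)
open import Relation.Nullary using (¬_)

record SimpleGraph (n : ℕ) : Set where
  field
    adj   : Fin n → Fin n → Bool
    sym   : ∀ i j → adj i j ≡ adj j i
    irref : ∀ i → adj i i ≡ false

-- A subgraph J of K_{n,n}: bip i j = true  iff  i ∼ j' in J.
-- Symmetric: i ∼ j' iff j ∼ i'.
record SymBipartite (n : ℕ) : Set where
  field
    bip : Fin n → Fin n → Bool
    sym : ∀ i j → bip i j ≡ bip j i

-- Vertices of G^(k+1): (k+1)-tuples, built as (prefix , last coordinate).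
Tuple : ℕ → ℕ → Set
Tuple n zero    = Fin n
Tuple n (suc k) = Tuple n k × Fin n

-- Adjacency in G^(k+1) (so SelfSimAdj G J 0 is G itself).
SelfSimAdj : ∀ {n} → SimpleGraph n → SymBipartite n → (k : ℕ) → Tuple n k → Tuple n k → Set
SelfSimAdj G J zero    a b = SimpleGraph.adj G a b ≡ true
SelfSimAdj G J (suc k) (u , a) (w , b) =
  (u ≡ w × SimpleGraph.adj G a b ≡ true)
  ⊎ (SelfSimAdj G J k u w × SymBipartite.bip J a b ≡ true)

ChromaticAtMost : ∀ {n} → SimpleGraph n → SymBipartite n → ℕ → ℕ → Set
ChromaticAtMost {n} G J k m =
  ∃ λ (c : Tuple n k → Fin m) → ∀ u w → SelfSimAdj G J k u w → c u ≢ c w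

-- χ_∞(G,J) ≤ m : since χ(G^k) is non-decreasing with limit χ_∞ (∞ if unbounded),
-- this holds iff χ(G^k) ≤ m for every k ≥ 1.
ChiInftyAtMost : ∀ {n} → SimpleGraph n → SymBipartite n → ℕ → Set
ChiInftyAtMost G J m = ∀ k → ChromaticAtMost G J k m

-- Colour a vertex (v_{i_1},…,v_{i_k}) of G^k by a pair (parity, residue) ∈ Bool × ℤ/n,
-- built coordinate by coordinate: a coordinate a that carries a loop (a,a') of J
-- translates the residue by a, any other coordinate resets the residue to a and
-- flips the parity. The hypothesis says exactly that a looped vertex of J has no
-- J-neighbour other than itself, so a J-edge (a,b') either is a loop, where the
-- translation by a is injective, or joins two distinct unlooped vertices, which
-- the reset residues a ≠ b separate. An edge of G between tuples with a common
-- prefix is separated because extending a fixed colour by distinct a, b gives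
-- distinct colours.
module Submission where

open import Defs
open import Data.Nat using (ℕ; zero; suc; _+_; _*_; _∸_; _%_; _<_; _≤_; NonZero)
open import Data.Nat.Properties using (+-assoc; +-comm; m+[n∸m]≡n; <⇒≤)
open import Data.Nat.DivMod using (_mod_; %-distribˡ-+; m%n%n≡m%n; [m+n]%n≡m%n; m<n⇒m%n≡m; m%n<n)
open import Data.Fin using (Fin; toℕ; _≟_)
open import Data.Fin.Properties using (toℕ-fromℕ<; toℕ-injective; toℕ<n; 2↔Bool; *↔×)
open import Data.Bool using (Bool; true; false; not)
open import Data.Product using (_×_; _,_; proj₁; proj₂)
open import Data.Product.Function.NonDependent.Propositional using (_×-↔_)
open import Data.Sum using (_⊎_; inj₁; inj₂)
open import Function using (_∘_; _↔_; _↣_; Injection)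
open import Function.Properties.Inverse using (↔-refl; ↔-sym; ↔-trans; ↔⇒↣)
open import Relation.Binary.PropositionalEquality
open import Relation.Nullary using (¬_; yes; no; contradiction)

[m%d+n]%d≡[m+n]%d : ∀ m n d .{{_ : NonZero d}} → (m % d + n) % d ≡ (m + n) % d
[m%d+n]%d≡[m+n]%d m n d = begin
  (m % d + n) % d           ≡⟨ %-distribˡ-+ (m % d) n d ⟩
  (m % d % d + n % d) % d   ≡⟨ cong (λ r → (r + n % d) % d) (m%n%n≡m%n m d) ⟩
  (m % d + n % d) % d       ≡⟨ %-distribˡ-+ m n d ⟨
  (m + n) % d               ∎
  where open ≡-Reasoning

[[m+a]%d+[d∸a]]%d≡m : ∀ {m a d} .{{_ : NonZero d}} → m < d → a ≤ d → ((m + a) % d + (d ∸ a)) % d ≡ m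
[[m+a]%d+[d∸a]]%d≡m {m} {a} {d} m<d a≤d = begin
  ((m + a) % d + (d ∸ a)) % d   ≡⟨ [m%d+n]%d≡[m+n]%d (m + a) (d ∸ a) d ⟩
  (m + a + (d ∸ a)) % d         ≡⟨ cong (_% d) (+-assoc m a (d ∸ a)) ⟩
  (m + (a + (d ∸ a))) % d       ≡⟨ cong (λ r → (m + r) % d) (m+[n∸m]≡n a≤d) ⟩
  (m + d) % d                   ≡⟨ [m+n]%n≡m%n m d ⟩
  m % d                         ≡⟨ m<n⇒m%n≡m m<d ⟩
  m                             ∎
  where open ≡-Reasoning

+-%-cancelʳ : ∀ {m n a d} .{{_ : NonZero d}} → m < d → n < d → a ≤ d →
              (m + a) % d ≡ (n + a) % d → m ≡ n
+-%-cancelʳ {m} {n} {a} {d} m<d n<d a≤d eq = begin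
  m                             ≡⟨ [[m+a]%d+[d∸a]]%d≡m m<d a≤d ⟨
  ((m + a) % d + (d ∸ a)) % d   ≡⟨ cong (λ r → (r + (d ∸ a)) % d) eq ⟩
  ((n + a) % d + (d ∸ a)) % d   ≡⟨ [[m+a]%d+[d∸a]]%d≡m n<d a≤d ⟩
  n                             ∎
  where open ≡-Reasoning

infixl 6 _⊕_

_⊕_ : ∀ {n} → Fin n → Fin n → Fin n
_⊕_ {suc n} x a = (toℕ x + toℕ a) mod suc n

toℕ-⊕ : ∀ {n} (x a : Fin (suc n)) → toℕ (x ⊕ a) ≡ (toℕ x + toℕ a) % suc n
toℕ-⊕ {n} x a = toℕ-fromℕ< (m%n<n (toℕ x + toℕ a) (suc n))

⊕-comm : ∀ {n} (x a : Fin n) → x ⊕ a ≡ a ⊕ x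
⊕-comm {suc n} x a = cong (_mod suc n) (+-comm (toℕ x) (toℕ a))

⊕-cancelʳ : ∀ {n} {x y} (a : Fin n) → x ⊕ a ≡ y ⊕ a → x ≡ y
⊕-cancelʳ {suc n} {x} {y} a eq = toℕ-injective
  (+-%-cancelʳ (toℕ<n x) (toℕ<n y) (<⇒≤ (toℕ<n a))
    (trans (sym (toℕ-⊕ x a)) (trans (cong toℕ eq) (toℕ-⊕ y a))))

⊕-cancelˡ : ∀ {n} (x : Fin n) {a b} → x ⊕ a ≡ x ⊕ b → a ≡ b
⊕-cancelˡ x {a} {b} eq = ⊕-cancelʳ x (trans (⊕-comm a x) (trans eq (⊕-comm x b)))

Colour : ℕ → Set
Colour n = Bool × Fin n

Colour↔Fin : ∀ {n} → Colour n ↔ Fin (2 * n)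
Colour↔Fin = ↔-trans (↔-sym 2↔Bool ×-↔ ↔-refl) (↔-sym *↔×)

extend : ∀ {n} → (looped : Bool) → Fin n → Colour n → Colour n
extend true  a (β , x) = (β , x ⊕ a)
extend false a (β , x) = (not β , a)

β≢notβ : ∀ {β} → β ≢ not β
β≢notβ {true}  ()
β≢notβ {false} ()

extend-cancelʳ : ∀ {n} ℓ ℓ′ {a b : Fin n} c → extend ℓ a c ≡ extend ℓ′ b c → a ≡ b
extend-cancelʳ true  true  (β , x) eq = ⊕-cancelˡ x (cong proj₂ eq)
extend-cancelʳ true  false (β , x) eq = contradiction (cong proj₁ eq) β≢notβ
extend-cancelʳ false true  (β , x) eq = contradiction (sym (cong proj₁ eq)) β≢notβ
extend-cancelʳ false false (β , x) eq = cong proj₂ eq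

extend-true-injective : ∀ {n} (a : Fin n) {c c′} → extend true a c ≡ extend true a c′ → c ≡ c′
extend-true-injective a {β , x} {γ , y} eq
  with refl ← cong proj₁ eq | refl ← ⊕-cancelʳ a (cong proj₂ eq) = refl

extend-false-residue : ∀ {n} {a b : Fin n} c c′ → extend false a c ≡ extend false b c′ → a ≡ b
extend-false-residue (β , x) (γ , y) eq = cong proj₂ eq

module _ {n} (G : SimpleGraph n) (J : SymBipartite n) where

  open SimpleGraph G using (adj; irref)
  open SymBipartite J using (bip) renaming (sym to bip-sym)

  adj⇒≢ : ∀ {a b} → adj a b ≡ true → a ≢ b
  adj⇒≢ {a} e refl with () ← trans (sym e) (irref a)

  chromaticAtMost-↣ : ∀ {k m} {C : Set} (f : C ↣ Fin m) (c : Tuple n k → C) →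
                      (∀ u w → SelfSimAdj G J k u w → c u ≢ c w) → ChromaticAtMost G J k m
  chromaticAtMost-↣ f c proper = to ∘ c , λ u w uw → proper u w uw ∘ injective
    where open Injection f

  module _ (loops-isolated : ∀ a b → bip a a ≡ true → bip a b ≡ true → a ≡ b) where

    J-edge-cases : ∀ {a b} → bip a b ≡ true →
                   (a ≡ b × bip a a ≡ true) ⊎ (a ≢ b × bip a a ≡ false × bip b b ≡ false)
    J-edge-cases {a} {b} ab with a ≟ b
    ... | yes refl = inj₁ (refl , ab)
    ... | no a≢b with bip a a in la | bip b b in lb
    ...   | true  | _     = contradiction (loops-isolated a b la ab) a≢b
    ...   | false | true  = contradiction (loops-isolated b a lb (trans (bip-sym b a) ab)) (a≢b ∘ sym)
    ...   | false | false = inj₂ (a≢b , refl , refl)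

    extend-along-J : ∀ {a b c c′} → bip a b ≡ true → c ≢ c′ →
                     extend (bip a a) a c ≢ extend (bip b b) b c′
    extend-along-J {a} {b} {c} {c′} ab c≢c′ with J-edge-cases ab
    ... | inj₁ (refl , la) rewrite la = c≢c′ ∘ extend-true-injective a
    ... | inj₂ (a≢b , la , lb) rewrite la | lb = a≢b ∘ extend-false-residue c c′

    colour : ∀ k → Tuple n k → Colour n
    colour zero    a       = (false , a)
    colour (suc k) (u , a) = extend (bip a a) a (colour k u)

    colour-proper : ∀ k u w → SelfSimAdj G J k u w → colour k u ≢ colour k w
    colour-proper zero    a       b       ab                 = adj⇒≢ ab ∘ cong proj₂
    colour-proper (suc k) (u , a) (_ , b) (inj₁ (refl , ab)) =
      adj⇒≢ ab ∘ extend-cancelʳ (bip a a) (bip b b) (colour k u)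
    colour-proper (suc k) (u , a) (w , b) (inj₂ (uw , ab))   =
      extend-along-J ab (colour-proper k u w uw)

theorem3p5 : (n : ℕ) (G : SimpleGraph n) (J : SymBipartite n) →
    (∀ (i j : Fin n) → i ≢ j →
      ¬ (SymBipartite.bip J i i ≡ true × SymBipartite.bip J i j ≡ true × SymBipartite.bip J j i ≡ true)) →
    ChiInftyAtMost G J (2 * n)
theorem3p5 n G J no-loop-with-edge k =
  chromaticAtMost-↣ G J (↔⇒↣ Colour↔Fin) (colour G J loops-isolated k)
    (colour-proper G J loops-isolated k)
  where
  open SymBipartite J using (bip) renaming (sym to bip-sym)

  loops-isolated : ∀ a b → bip a a ≡ true → bip a b ≡ true → a ≡ b
  loops-isolated a b aa ab with a ≟ b
  ... | yes a≡b = a≡b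
  ... | no  a≢b = contradiction (aa , ab , trans (bip-sym b a) ab) (no-loop-with-edge a b a≢b)
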